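{- Let $X$ be a finite asymmetric graph, let $p$ be a prime, and let $S$ be a clique of $X$ with $|S|=p-1$. Suppose that the number of common neighbours $\left|\bigcap_{w\in S}N(w,X)\right|$ of $S$ differs from the number of common neighbours of every other clique of $X$ of order $p-1$, and that this number is not divisible by $p$. Then $X$ is not the induced neighbourhood of a finite vertex-transitive graph.
   Context: All graphs are simple. $N(v,X)$ is the set of neighbours of $v$ in $X$. A graph is asymmetric if its only automorphism is the identity. $X$ is the induced neighbourhood of $Y$ if $\langle N(y,Y)\rangle\cong X$ for every vertex $y$ of $Y$, where $\langle N(y,Y)\rangle$ is the subgraph induced on $N(y,Y)$. -}

module Defs where

open import Data.Nat using (ℕ; zero; suc)
open import Data.Bool using (Bool; true; false; not; _∨_; _∧_)
open import Data.Fin using (Fin)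
open import Data.Fin.Subset using (Subset; _∈_; ∣_∣)
open import Data.Vec using (Vec; lookup; tabulate)
open import Data.List using (allFin)
open import Data.Bool.ListAction using (all)
open import Data.Product using (Σ; ∃; _×_; _,_)
open import Relation.Binary.PropositionalEquality using (_≡_; _≢_)
open import Relation.Nullary using (¬_)
open import Function.Bundles using (_⇔_)

record Graph (n : ℕ) : Set where
  field
    adj    : Fin n → Fin n → Bool
    sym    : ∀ u v → adj u v ≡ adj v u
    irrefl : ∀ v → adj v v ≡ false
open Graph public

record Automorphism {n : ℕ} (G : Graph n) : Set where
  field
    fun     : Fin n → Fin n
    inv     : Fin n → Fin n
    inv-l   : ∀ v → inv (fun v) ≡ v
    inv-r   : ∀ v → fun (inv v) ≡ v
    preserv : ∀ u v → adj G (fun u) (fun v) ≡ adj G u v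
open Automorphism public

Asymmetric : {n : ℕ} → Graph n → Set
Asymmetric G = (σ : Automorphism G) → ∀ v → fun σ v ≡ v

VertexTransitive : {m : ℕ} → Graph m → Set
VertexTransitive Y = ∀ y y′ → Σ (Automorphism Y) λ σ → fun σ y ≡ y′

IsClique : {n : ℕ} → Graph n → Subset n → Set
IsClique G S = ∀ u v → u ∈ S → v ∈ S → u ≢ v → adj G u v ≡ true

commonNbrs : {n : ℕ} → Graph n → Subset n → Subset n
commonNbrs {n} G S =
  tabulate λ v → all (λ w → not (lookup S w) ∨ adj G w v) (allFin n)

-- X is isomorphic to the subgraph of Y induced on N(y, Y):
-- an injective map f from the vertices of X onto N(y, Y) such that
-- adjacency in Y between images equals adjacency in X.
IsoToInducedNbhd : {n m : ℕ} → Graph n → Graph m → Fin m → Set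
IsoToInducedNbhd {n} {m} X Y y =
  Σ (Fin n → Fin m) λ f →
      (∀ i j → f i ≡ f j → i ≡ j)
    × (∀ z → (adj Y y z ≡ true) ⇔ (∃ λ i → f i ≡ z))
    × (∀ i j → adj Y (f i) (f j) ≡ adj X i j)

InducedNbhdOf : {n m : ℕ} → Graph n → Graph m → Set
InducedNbhdOf X Y = ∀ y → IsoToInducedNbhd X Y y

{-# OPTIONS --safe #-}
-- Let f : X ≅ N(y) for a vertex y of Y. As X is asymmetric, such isomorphisms are unique, so an
-- automorphism of Y fixing a vertex fixes its neighbourhood pointwise. Put K = {y} ∪ f(S), a
-- p-clique of Y whose common neighbours correspond to those of S, and take an automorphism h with
-- h y = f s for some s ∈ S. Pulling K back along h ∘ f gives a clique of X of order p - 1 with as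
-- many common neighbours as S, hence S itself, so h maps K into K. If d is the least period of y
-- under h, rigidity gives every vertex of K and of its common neighbourhood least period d too;
-- so d divides |K| = p, whence d = p, and p divides the number of common neighbours of S.
module Submission where

open import Defs renaming (sym to adj-sym)
open import Data.Bool using (Bool; true; false; not; _∨_; T)
import Data.Bool.Properties as Bool
open import Data.Fin using (Fin; zero; suc; toℕ; fromℕ<)
open import Data.Fin.Properties using (any?; _≟_; ¬Fin0; pigeonhole)
import Data.Fin.Properties as Fin
open import Data.Fin.Subset
  using (Subset; _∈_; _∉_; _⊆_; _⊂_; ∣_∣; ⊤; ⁅_⁆; _∪_; _∩_; _─_; Empty; Nonempty; inside; outside)
open import Data.Fin.Subset.Properties
  using (_∈?_; nonempty?; ⊆-antisym; Empty-unique; ∣⊥∣≡0; ∣⊤∣≡n; ∈⊤; ∣⁅x⁆∣≡1; x∈⁅x⁆; x∈⁅y⁆⇒x≡y;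
         x∈p∪q⁺; x∈p∪q⁻; x∈p∩q⁺; x∈p∩q⁻; x∈p∧x∉q⇒x∈p─q; p─q⊆p; p∩q≢∅⇒p─q⊂p)
open import Data.Fin.Subset.Induction using (⊂-wellFounded)
open import Data.List using (allFin)
open import Data.List.Membership.Propositional.Properties using (∈-allFin)
open import Data.List.Relation.Unary.All as All using (All)
open import Data.List.Relation.Unary.All.Properties using (all⁺; all⁻; tabulate⁺)
open import Data.Nat using (ℕ; zero; suc; _+_; _∸_; _<_)
open import Data.Nat.Base using (nonTrivial⇒n>1)
open import Data.Nat.Divisibility using (_∣_; _∣0; ∣-refl; ∣m∣n⇒∣m+n)
open import Data.Nat.Induction using (<-wellFounded)
open import Data.Nat.Primality using (Prime; prime⇒irreducible; prime⇒nonTrivial)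
open import Data.Nat.Properties
  using (+-suc; +-comm; suc-injective; _<?_; anyUpTo?; <⇒≤; >⇒≢; n<1+n; ≤-<-trans; m≤n⇒m<n∨m≡n;
         m<n⇒0<n∸m; m+[n∸m]≡n; m∸n+n≡m; m∸n≤m)
open import Data.Product using (∃; _×_; _,_; proj₁; proj₂)
open import Data.Sum using (_⊎_; inj₁; inj₂; [_,_]′)
import Data.Sum as Sum
open import Data.Vec using ([]; _∷_; lookup; tabulate; here; there)
open import Data.Vec.Properties using (lookup∘tabulate; []=⇒lookup; lookup⇒[]=)
import Data.Vec.Properties as Vec
open import Function using (_∘_; _⇔_; mk⇔; Equivalence; Injective; case_of_)
import Function.Endo.Propositional as Endo
open import Induction.WellFounded using (Acc; acc)
open import Level using (Level)
open import Relation.Binary.Definitions using (tri<; tri≈; tri>)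
open import Relation.Binary.PropositionalEquality
open import Relation.Nullary using (¬_; yes; no; does; contradiction)
open import Relation.Nullary.Decidable using (dec-true; _×-dec_)
open import Relation.Unary using (Pred; Decidable)

open module Iterate {A : Set} = Endo A using (_^_; ^-homo)

private
  variable
    a b n : ℕ
    ℓ : Level

∈-tabulate⁺ : {f : Fin n → Bool} {x : Fin n} → f x ≡ true → x ∈ tabulate f
∈-tabulate⁺ {f = f} {x} fx = lookup⇒[]= x (tabulate f) (trans (lookup∘tabulate f x) fx)

∈-tabulate⁻ : {f : Fin n → Bool} {x : Fin n} → x ∈ tabulate f → f x ≡ true
∈-tabulate⁻ {f = f} {x} x∈ = trans (sym (lookup∘tabulate f x)) ([]=⇒lookup x∈)

decSubset : {P : Pred (Fin n) ℓ} → Decidable P → Subset n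
decSubset P? = tabulate (does ∘ P?)

∈-decSubset⁺ : {P : Pred (Fin n) ℓ} (P? : Decidable P) {x : Fin n} → P x → x ∈ decSubset P?
∈-decSubset⁺ P? {x} px = ∈-tabulate⁺ (dec-true (P? x) px)

∈-decSubset⁻ : {P : Pred (Fin n) ℓ} (P? : Decidable P) {x : Fin n} → x ∈ decSubset P? → P x
∈-decSubset⁻ P? {x} x∈ with P? x | ∈-tabulate⁻ {f = does ∘ P?} x∈
... | yes px | _ = px

image? : (φ : Fin a → Fin b) (p : Subset a) → Decidable (λ y → ∃ λ x → x ∈ p × φ x ≡ y)
image? φ p y = any? (λ x → x ∈? p ×-dec φ x ≟ y)

image : (Fin a → Fin b) → Subset a → Subset b
image φ p = decSubset (image? φ p)

∈-image⁺ : (φ : Fin a → Fin b) {p : Subset a} {x : Fin a} → x ∈ p → φ x ∈ image φ p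
∈-image⁺ φ {p} x∈p = ∈-decSubset⁺ (image? φ p) (_ , x∈p , refl)

∈-image⁻ : (φ : Fin a → Fin b) {p : Subset a} {y : Fin b} → y ∈ image φ p → ∃ λ x → x ∈ p × φ x ≡ y
∈-image⁻ φ {p} = ∈-decSubset⁻ (image? φ p)

x∈p─q⇒x∉q : {p q : Subset n} {x : Fin n} → x ∈ p ─ q → x ∉ q
x∈p─q⇒x∉q {p = _ ∷ _} {outside ∷ _} here       ()
x∈p─q⇒x∉q {p = _ ∷ _} {_ ∷ _}       (there x∈) (there x∈q) = x∈p─q⇒x∉q x∈ x∈q

∣p∪q∣≡∣p∣+∣q∣ : (p q : Subset n) → Empty (p ∩ q) → ∣ p ∪ q ∣ ≡ ∣ p ∣ + ∣ q ∣
∣p∪q∣≡∣p∣+∣q∣ []            []            _        = refl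
∣p∪q∣≡∣p∣+∣q∣ (inside ∷ p)  (inside ∷ q)  disjoint = contradiction (zero , here) disjoint
∣p∪q∣≡∣p∣+∣q∣ (inside ∷ p)  (outside ∷ q) disjoint =
  cong suc (∣p∪q∣≡∣p∣+∣q∣ p q λ (x , x∈) → disjoint (suc x , there x∈))
∣p∪q∣≡∣p∣+∣q∣ (outside ∷ p) (inside ∷ q)  disjoint =
  trans (cong suc (∣p∪q∣≡∣p∣+∣q∣ p q λ (x , x∈) → disjoint (suc x , there x∈))) (sym (+-suc ∣ p ∣ ∣ q ∣))
∣p∪q∣≡∣p∣+∣q∣ (outside ∷ p) (outside ∷ q) disjoint =
  ∣p∪q∣≡∣p∣+∣q∣ p q λ (x , x∈) → disjoint (suc x , there x∈)

∣p∣>0⇒Nonempty : (p : Subset n) → 0 < ∣ p ∣ → Nonempty p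
∣p∣>0⇒Nonempty {n} p ∣p∣>0 with nonempty? p
... | yes p-nonempty = p-nonempty
... | no  p-empty    = contradiction (trans (cong ∣_∣ (Empty-unique p-empty)) (∣⊥∣≡0 n)) (>⇒≢ ∣p∣>0)

q⊆p⇒∣p∣≡∣q∣+∣p─q∣ : {p q : Subset n} → q ⊆ p → ∣ p ∣ ≡ ∣ q ∣ + ∣ p ─ q ∣
q⊆p⇒∣p∣≡∣q∣+∣p─q∣ {p = p} {q} q⊆p = begin
  ∣ p ∣            ≡⟨ cong ∣_∣ p≡q∪[p─q] ⟩
  ∣ q ∪ (p ─ q) ∣  ≡⟨ ∣p∪q∣≡∣p∣+∣q∣ q (p ─ q) disjoint ⟩
  ∣ q ∣ + ∣ p ─ q ∣ ∎
  where
  open ≡-Reasoning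
  p≡q∪[p─q] : p ≡ q ∪ (p ─ q)
  p≡q∪[p─q] = ⊆-antisym split (λ x∈ → [ q⊆p , p─q⊆p p q ]′ (x∈p∪q⁻ q (p ─ q) x∈))
    where
    split : p ⊆ q ∪ (p ─ q)
    split {x} x∈p with x ∈? q
    ... | yes x∈q = x∈p∪q⁺ (inj₁ x∈q)
    ... | no  x∉q = x∈p∪q⁺ (inj₂ (x∈p∧x∉q⇒x∈p─q x∈p x∉q))
  disjoint : Empty (q ∩ (p ─ q))
  disjoint (x , x∈) = let x∈q , x∈p─q = x∈p∩q⁻ q (p ─ q) x∈ in x∈p─q⇒x∉q x∈p─q x∈q

image-outside∷ : (φ : Fin (suc a) → Fin b) (p : Subset a) → image φ (outside ∷ p) ≡ image (φ ∘ suc) p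
image-outside∷ φ p = ⊆-antisym
  (λ y∈ → case ∈-image⁻ φ {outside ∷ p} y∈ of λ { (suc x , there x∈ , refl) → ∈-image⁺ (φ ∘ suc) x∈ })
  (λ y∈ → case ∈-image⁻ (φ ∘ suc) y∈ of λ { (x , x∈ , refl) → ∈-image⁺ φ {outside ∷ p} (there x∈) })

image-inside∷ : (φ : Fin (suc a) → Fin b) (p : Subset a) →
                image φ (inside ∷ p) ≡ ⁅ φ zero ⁆ ∪ image (φ ∘ suc) p
image-inside∷ φ p = ⊆-antisym
  (λ y∈ → case ∈-image⁻ φ {inside ∷ p} y∈ of λ
    { (zero  , _        , refl) → x∈p∪q⁺ (inj₁ (x∈⁅x⁆ (φ zero)))
    ; (suc x , there x∈ , refl) → x∈p∪q⁺ (inj₂ (∈-image⁺ (φ ∘ suc) x∈)) })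
  (λ y∈ → case x∈p∪q⁻ ⁅ φ zero ⁆ _ y∈ of λ
    { (inj₁ y∈⁅φ0⁆) → subst (_∈ image φ (inside ∷ p)) (sym (x∈⁅y⁆⇒x≡y _ y∈⁅φ0⁆)) (∈-image⁺ φ {inside ∷ p} here)
    ; (inj₂ y∈)     → case ∈-image⁻ (φ ∘ suc) y∈ of λ { (x , x∈ , refl) → ∈-image⁺ φ {inside ∷ p} (there x∈) } })

∣image∣≡∣p∣ : (φ : Fin a → Fin b) → Injective _≡_ _≡_ φ → (p : Subset a) → ∣ image φ p ∣ ≡ ∣ p ∣
∣image∣≡∣p∣ {b = b} φ φ-inj [] =
  trans (cong ∣_∣ (Empty-unique λ (_ , y∈) → ¬Fin0 (proj₁ (∈-image⁻ φ {[]} y∈)))) (∣⊥∣≡0 b)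
∣image∣≡∣p∣ φ φ-inj (outside ∷ p) =
  trans (cong ∣_∣ (image-outside∷ φ p)) (∣image∣≡∣p∣ (φ ∘ suc) (Fin.suc-injective ∘ φ-inj) p)
∣image∣≡∣p∣ φ φ-inj (inside ∷ p) = begin
  ∣ image φ (inside ∷ p) ∣                ≡⟨ cong ∣_∣ (image-inside∷ φ p) ⟩
  ∣ ⁅ φ zero ⁆ ∪ image (φ ∘ suc) p ∣       ≡⟨ ∣p∪q∣≡∣p∣+∣q∣ ⁅ φ zero ⁆ _ disjoint ⟩
  ∣ ⁅ φ zero ⁆ ∣ + ∣ image (φ ∘ suc) p ∣   ≡⟨ cong₂ _+_ (∣⁅x⁆∣≡1 (φ zero)) ∣image∣≡∣p∣-suc ⟩
  suc ∣ p ∣                               ∎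
  where
  open ≡-Reasoning
  ∣image∣≡∣p∣-suc : ∣ image (φ ∘ suc) p ∣ ≡ ∣ p ∣
  ∣image∣≡∣p∣-suc = ∣image∣≡∣p∣ (φ ∘ suc) (Fin.suc-injective ∘ φ-inj) p
  disjoint : Empty (⁅ φ zero ⁆ ∩ image (φ ∘ suc) p)
  disjoint (y , y∈) with x∈p∩q⁻ ⁅ φ zero ⁆ _ y∈
  ... | y∈⁅φ0⁆ , y∈image with ∈-image⁻ (φ ∘ suc) y∈image
  ... | x , _ , φsx≡y = case φ-inj (trans φsx≡y (x∈⁅y⁆⇒x≡y _ y∈⁅φ0⁆)) of λ ()

module _ (G : Graph n) (S : Subset n) {x : Fin n} where

  private
    isNbrIfInS : Fin n → Bool
    isNbrIfInS w = not (lookup S w) ∨ adj G w x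

  ∈-commonNbrs⁺ : (∀ {w} → w ∈ S → adj G w x ≡ true) → x ∈ commonNbrs G S
  ∈-commonNbrs⁺ nbr = ∈-tabulate⁺ (Equivalence.to Bool.T-≡ (all⁻ isNbrIfInS (tabulate⁺ nbrIfInS)))
    where
    nbrIfInS : ∀ w → T (isNbrIfInS w)
    nbrIfInS w with lookup S w in w∈S
    ... | true  = Equivalence.from Bool.T-≡ (nbr (lookup⇒[]= w S w∈S))
    ... | false = _

  ∈-commonNbrs⁻ : x ∈ commonNbrs G S → ∀ {w} → w ∈ S → adj G w x ≡ true
  ∈-commonNbrs⁻ x∈ {w} w∈S = Equivalence.to Bool.T-≡
    (subst (λ s → T (not s ∨ adj G w x)) ([]=⇒lookup w∈S) (All.lookup nbrIfInS (∈-allFin w)))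
    where
    nbrIfInS : All (T ∘ isNbrIfInS) (allFin n)
    nbrIfInS = all⁺ isNbrIfInS (allFin n) (Equivalence.from Bool.T-≡ (∈-tabulate⁻ x∈))

leastWitness : {P : Pred ℕ ℓ} → Decidable P → ∀ {k} → P k → ∃ λ d → P d × (∀ {i} → i < d → ¬ P i)
leastWitness {P = P} P? {k} = go (<-wellFounded k)
  where
  go : ∀ {k} → Acc _<_ k → P k → ∃ λ d → P d × (∀ {i} → i < d → ¬ P i)
  go {k} (acc below) pk with anyUpTo? P? k
  ... | yes (i , i<k , pi) = go (below i<k) pi
  ... | no  none           = k , pk , λ i<k pi → none (_ , i<k , pi)

module _ {A : Set} (g : A → A) where

  ^-suc′ : ∀ k x → (g ^ k) (g x) ≡ (g ^ suc k) x
  ^-suc′ k x = trans (cong-app (sym (^-homo g k 1)) x) (cong (λ m → (g ^ m) x) (+-comm k 1))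

  ^-injective : Injective _≡_ _≡_ g → ∀ k → Injective _≡_ _≡_ (g ^ k)
  ^-injective g-inj zero    eq = eq
  ^-injective g-inj (suc k) eq = ^-injective g-inj k (g-inj eq)

  record LeastPeriod (x : A) (d : ℕ) : Set where
    field
      positive : 0 < d
      returns  : (g ^ d) x ≡ x
      minimal  : ∀ {i} → 0 < i → i < d → (g ^ i) x ≢ x

module _ {N : ℕ} {g : Fin N → Fin N} (g-inj : Injective _≡_ _≡_ g) where

  returns-eventually : ∀ x → ∃ λ k → 0 < k × (g ^ k) x ≡ x
  returns-eventually x with pigeonhole (n<1+n N) (λ (i : Fin (suc N)) → (g ^ toℕ i) x)
  ... | i , j , i<j , gⁱx≡gʲx = toℕ j ∸ toℕ i , m<n⇒0<n∸m i<j , ^-injective g g-inj (toℕ i) (begin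
    (g ^ toℕ i) ((g ^ (toℕ j ∸ toℕ i)) x) ≡⟨ cong-app (^-homo g (toℕ i) _) x ⟨
    (g ^ (toℕ i + (toℕ j ∸ toℕ i))) x     ≡⟨ cong (λ k → (g ^ k) x) (m+[n∸m]≡n (<⇒≤ i<j)) ⟩
    (g ^ toℕ j) x                         ≡⟨ gⁱx≡gʲx ⟨
    (g ^ toℕ i) x                         ∎)
    where open ≡-Reasoning

  leastPeriod : ∀ x → ∃ (LeastPeriod g x)
  leastPeriod x with returns-eventually x
  ... | k , k>0 , gᵏx≡x with leastWitness (λ i → 0 <? i ×-dec (g ^ i) x ≟ x) (k>0 , gᵏx≡x)
  ... | d , (d>0 , gᵈx≡x) , below = d , record
    { positive = d>0
    ; returns  = gᵈx≡x
    ; minimal  = λ i>0 i<d gⁱx≡x → below i<d (i>0 , gⁱx≡x)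
    }

record UniformOrbits {N : ℕ} (g : Fin N → Fin N) (d : ℕ) (A : Subset N) : Set where
  field
    closed : ∀ {x} → x ∈ A → g x ∈ A
    period : ∀ {x} → x ∈ A → LeastPeriod g x d

module _ {N d : ℕ} {g : Fin N → Fin N} {A : Subset N} (U : UniformOrbits g d A) where

  open UniformOrbits U

  ^-closed : ∀ k {x} → x ∈ A → (g ^ k) x ∈ A
  ^-closed zero    x∈A = x∈A
  ^-closed (suc k) x∈A = closed (^-closed k x∈A)

  ^[d∸1]-rightInverse : ∀ {x} → x ∈ A → g ((g ^ (d ∸ 1)) x) ≡ x
  ^[d∸1]-rightInverse {x} x∈A = trans (cong (λ k → (g ^ k) x) (m+[n∸m]≡n positive)) returns
    where open LeastPeriod (period x∈A)

  uniformOrbits⇒surjective : ∀ {x} → x ∈ A → ∃ λ x′ → x′ ∈ A × g x′ ≡ x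
  uniformOrbits⇒surjective {x} x∈A = (g ^ (d ∸ 1)) x , ^-closed (d ∸ 1) x∈A , ^[d∸1]-rightInverse x∈A

  module Orbit {a : Fin N} (a∈A : a ∈ A) where

    open LeastPeriod (period a∈A)

    walk : Fin d → Fin N
    walk i = (g ^ toℕ i) a

    orbit : Subset N
    orbit = image walk ⊤

    iterates-distinct : ∀ {i j : Fin d} → toℕ i < toℕ j → (g ^ toℕ i) a ≢ (g ^ toℕ j) a
    iterates-distinct {i} {j} i<j gⁱa≡gʲa = LeastPeriod.minimal (period (^-closed (toℕ i) a∈A))
      (m<n⇒0<n∸m i<j) (≤-<-trans (m∸n≤m (toℕ j) (toℕ i)) (Fin.toℕ<n j)) (begin
        (g ^ (toℕ j ∸ toℕ i)) ((g ^ toℕ i) a) ≡⟨ cong-app (^-homo g (toℕ j ∸ toℕ i) (toℕ i)) a ⟨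
        (g ^ (toℕ j ∸ toℕ i + toℕ i)) a       ≡⟨ cong (λ k → (g ^ k) a) (m∸n+n≡m (<⇒≤ i<j)) ⟩
        (g ^ toℕ j) a                         ≡⟨ gⁱa≡gʲa ⟨
        (g ^ toℕ i) a                         ∎)
      where open ≡-Reasoning

    walk-injective : Injective _≡_ _≡_ walk
    walk-injective {i} {j} gⁱa≡gʲa with Fin.<-cmp i j
    ... | tri≈ _ i≡j _ = i≡j
    ... | tri< i<j _ _ = contradiction gⁱa≡gʲa (iterates-distinct i<j)
    ... | tri> _ _ j<i = contradiction (sym gⁱa≡gʲa) (iterates-distinct j<i)

    ∣orbit∣≡d : ∣ orbit ∣ ≡ d
    ∣orbit∣≡d = trans (∣image∣≡∣p∣ walk walk-injective ⊤) (∣⊤∣≡n d)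

    iterate∈orbit : ∀ {k} → k < d → (g ^ k) a ∈ orbit
    iterate∈orbit {k} k<d = subst (_∈ orbit) walk-fromℕ< (∈-image⁺ walk {⊤} {fromℕ< k<d} ∈⊤)
      where
      walk-fromℕ< : walk (fromℕ< k<d) ≡ (g ^ k) a
      walk-fromℕ< = cong (λ k → (g ^ k) a) (Fin.toℕ-fromℕ< k<d)

    a∈orbit : a ∈ orbit
    a∈orbit = iterate∈orbit positive

    orbit⊆A : orbit ⊆ A
    orbit⊆A x∈ with ∈-image⁻ walk {⊤} x∈
    ... | i , _ , refl = ^-closed (toℕ i) a∈A

    orbit-closed : ∀ {x} → x ∈ orbit → g x ∈ orbit
    orbit-closed x∈ with ∈-image⁻ walk {⊤} x∈
    ... | i , _ , refl with m≤n⇒m<n∨m≡n (Fin.toℕ<n i)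
    ... | inj₁ i+1<d = iterate∈orbit i+1<d
    ... | inj₂ i+1≡d = subst (_∈ orbit) (sym (trans (cong (λ k → (g ^ k) a) i+1≡d) returns)) a∈orbit

    ^-orbit-closed : ∀ k {x} → x ∈ orbit → (g ^ k) x ∈ orbit
    ^-orbit-closed zero    x∈ = x∈
    ^-orbit-closed (suc k) x∈ = orbit-closed (^-orbit-closed k x∈)

    A─orbit-uniform : UniformOrbits g d (A ─ orbit)
    A─orbit-uniform = record
      { closed = λ {x} x∈ → x∈p∧x∉q⇒x∈p─q (closed (p─q⊆p A orbit x∈)) λ gx∈orbit →
          x∈p─q⇒x∉q x∈ (subst (_∈ orbit)
            (trans (^-suc′ g (d ∸ 1) x) (^[d∸1]-rightInverse (p─q⊆p A orbit x∈)))
            (^-orbit-closed (d ∸ 1) gx∈orbit))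
      ; period = period ∘ p─q⊆p A orbit
      }

    ∣A∣≡d+∣A─orbit∣ : ∣ A ∣ ≡ d + ∣ A ─ orbit ∣
    ∣A∣≡d+∣A─orbit∣ = trans (q⊆p⇒∣p∣≡∣q∣+∣p─q∣ orbit⊆A) (cong (_+ ∣ A ─ orbit ∣) ∣orbit∣≡d)

    A─orbit⊂A : A ─ orbit ⊂ A
    A─orbit⊂A = p∩q≢∅⇒p─q⊂p A orbit (a , x∈p∩q⁺ (a∈A , a∈orbit))

uniformOrbits⇒d∣∣A∣ : {N d : ℕ} {g : Fin N → Fin N} {A : Subset N} → UniformOrbits g d A → d ∣ ∣ A ∣
uniformOrbits⇒d∣∣A∣ {N} {d} {g} {A} = go (⊂-wellFounded A)
  where
  go : ∀ {A} → Acc _⊂_ A → UniformOrbits g d A → d ∣ ∣ A ∣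
  go {A} (acc smaller) U with nonempty? A
  ... | no  A-empty = subst (d ∣_) (sym (trans (cong ∣_∣ (Empty-unique A-empty)) (∣⊥∣≡0 N))) (d ∣0)
  ... | yes (a , a∈A) =
    subst (d ∣_) (sym ∣A∣≡d+∣A─orbit∣) (∣m∣n⇒∣m+n ∣-refl (go (smaller A─orbit⊂A) A─orbit-uniform))
    where open Orbit U a∈A

module _ {m : ℕ} {Y : Graph m} where

  fun-injective : (σ : Automorphism Y) → Injective _≡_ _≡_ (fun σ)
  fun-injective σ {u} {v} σu≡σv = trans (sym (inv-l σ u)) (trans (cong (inv σ) σu≡σv) (inv-l σ v))

  inv-preserv : (σ : Automorphism Y) → ∀ u v → adj Y (inv σ u) (inv σ v) ≡ adj Y u v
  inv-preserv σ u v = trans (sym (preserv σ (inv σ u) (inv σ v))) (cong₂ (adj Y) (inv-r σ u) (inv-r σ v))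

  idᴬ : Automorphism Y
  idᴬ = record
    { fun = λ x → x ; inv = λ x → x ; inv-l = λ _ → refl ; inv-r = λ _ → refl ; preserv = λ _ _ → refl }

  _∘ᴬ_ : Automorphism Y → Automorphism Y → Automorphism Y
  σ ∘ᴬ τ = record
    { fun     = fun σ ∘ fun τ
    ; inv     = inv τ ∘ inv σ
    ; inv-l   = λ x → trans (cong (inv τ) (inv-l σ (fun τ x))) (inv-l τ x)
    ; inv-r   = λ x → trans (cong (fun σ) (inv-r τ (inv σ x))) (inv-r σ x)
    ; preserv = λ u v → trans (preserv σ (fun τ u) (fun τ v)) (preserv τ u v)
    }

  _^ᴬ_ : Automorphism Y → ℕ → Automorphism Y
  σ ^ᴬ zero  = idᴬ
  σ ^ᴬ suc k = σ ∘ᴬ (σ ^ᴬ k)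

  fun-^ᴬ : ∀ σ k x → fun (σ ^ᴬ k) x ≡ (fun σ ^ k) x
  fun-^ᴬ σ zero    x = refl
  fun-^ᴬ σ (suc k) x = cong (fun σ) (fun-^ᴬ σ k x)

  commonNbrs-invariant : (σ : Automorphism Y) {K : Subset m} →
    (∀ {x} → x ∈ K → ∃ λ x′ → x′ ∈ K × fun σ x′ ≡ x) →
    ∀ {z} → z ∈ commonNbrs Y K → fun σ z ∈ commonNbrs Y K
  commonNbrs-invariant σ {K} K⊆σK {z} z∈ = ∈-commonNbrs⁺ Y K adjacent
    where
    adjacent : ∀ {k} → k ∈ K → adj Y k (fun σ z) ≡ true
    adjacent k∈K with K⊆σK k∈K
    ... | k′ , k′∈K , refl = trans (preserv σ k′ z) (∈-commonNbrs⁻ Y K z∈ k′∈K)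

module NbhdIso {n m : ℕ} (X : Graph n) (Y : Graph m) {y : Fin m} (iso : IsoToInducedNbhd X Y y) where

  embed : Fin n → Fin m
  embed = proj₁ iso

  embed-injective : Injective _≡_ _≡_ embed
  embed-injective = proj₁ (proj₂ iso) _ _

  embed-adj : ∀ i j → adj Y (embed i) (embed j) ≡ adj X i j
  embed-adj = proj₂ (proj₂ (proj₂ iso))

  adj-embed : ∀ i → adj Y y (embed i) ≡ true
  adj-embed i = Equivalence.from (proj₁ (proj₂ (proj₂ iso)) (embed i)) (i , refl)

  pull : ∀ {z} → adj Y y z ≡ true → Fin n
  pull {z} yz = proj₁ (Equivalence.to (proj₁ (proj₂ (proj₂ iso)) z) yz)

  embed-pull : ∀ {z} (yz : adj Y y z ≡ true) → embed (pull yz) ≡ z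
  embed-pull {z} yz = proj₂ (Equivalence.to (proj₁ (proj₂ (proj₂ iso)) z) yz)

  embed≢y : ∀ i → embed i ≢ y
  embed≢y i embed-i≡y =
    case trans (sym (irrefl Y y)) (subst (λ z → adj Y y z ≡ true) embed-i≡y (adj-embed i)) of λ ()

  cone : Subset n → Subset m
  cone S = ⁅ y ⁆ ∪ image embed S

  y∈cone : ∀ S → y ∈ cone S
  y∈cone S = x∈p∪q⁺ (inj₁ (x∈⁅x⁆ y))

  embed∈cone : ∀ {S i} → i ∈ S → embed i ∈ cone S
  embed∈cone i∈S = x∈p∪q⁺ (inj₂ (∈-image⁺ embed i∈S))

  ∈-cone⁻ : ∀ S {z} → z ∈ cone S → z ≡ y ⊎ ∃ λ i → i ∈ S × embed i ≡ z
  ∈-cone⁻ S z∈ = Sum.map (x∈⁅y⁆⇒x≡y y) (∈-image⁻ embed) (x∈p∪q⁻ ⁅ y ⁆ _ z∈)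

  cone⊆closedNbhd : ∀ S {z} → z ∈ cone S → z ≡ y ⊎ adj Y y z ≡ true
  cone⊆closedNbhd S z∈ with ∈-cone⁻ S z∈
  ... | inj₁ z≡y           = inj₁ z≡y
  ... | inj₂ (i , _ , refl) = inj₂ (adj-embed i)

  ∣cone∣ : ∀ S → ∣ cone S ∣ ≡ suc ∣ S ∣
  ∣cone∣ S = begin
    ∣ ⁅ y ⁆ ∪ image embed S ∣      ≡⟨ ∣p∪q∣≡∣p∣+∣q∣ ⁅ y ⁆ _ disjoint ⟩
    ∣ ⁅ y ⁆ ∣ + ∣ image embed S ∣  ≡⟨ cong₂ _+_ (∣⁅x⁆∣≡1 y) (∣image∣≡∣p∣ embed embed-injective S) ⟩
    suc ∣ S ∣                     ∎
    where
    open ≡-Reasoning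
    disjoint : Empty (⁅ y ⁆ ∩ image embed S)
    disjoint (z , z∈) with x∈p∩q⁻ ⁅ y ⁆ _ z∈
    ... | z∈⁅y⁆ , z∈image with ∈-image⁻ embed z∈image
    ... | i , _ , embed-i≡z = embed≢y i (trans embed-i≡z (x∈⁅y⁆⇒x≡y y z∈⁅y⁆))

  cone-clique : ∀ {S} → IsClique X S → IsClique Y (cone S)
  cone-clique {S} S-clique u v u∈ v∈ u≢v with ∈-cone⁻ S u∈ | ∈-cone⁻ S v∈
  ... | inj₁ refl             | inj₁ refl             = contradiction refl u≢v
  ... | inj₁ refl             | inj₂ (j , _ , refl)   = adj-embed j
  ... | inj₂ (i , _ , refl)   | inj₁ refl             = trans (adj-sym Y (embed i) y) (adj-embed i)
  ... | inj₂ (i , i∈ , refl)  | inj₂ (j , j∈ , refl)  =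
    trans (embed-adj i j) (S-clique i j i∈ j∈ (u≢v ∘ cong embed))

  commonNbrs-cone : ∀ S → commonNbrs Y (cone S) ≡ image embed (commonNbrs X S)
  commonNbrs-cone S = ⊆-antisym pulled pushed
    where
    pulled : commonNbrs Y (cone S) ⊆ image embed (commonNbrs X S)
    pulled {z} z∈ = subst (_∈ image embed (commonNbrs X S)) (embed-pull yz)
      (∈-image⁺ embed (∈-commonNbrs⁺ X S λ {w} w∈S → trans (sym (embed-adj w (pull yz)))
        (subst (λ u → adj Y (embed w) u ≡ true) (sym (embed-pull yz))
          (∈-commonNbrs⁻ Y (cone S) z∈ (embed∈cone w∈S)))))
      where
      yz : adj Y y z ≡ true
      yz = ∈-commonNbrs⁻ Y (cone S) z∈ (y∈cone S)
    pushed : image embed (commonNbrs X S) ⊆ commonNbrs Y (cone S)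
    pushed z∈ with ∈-image⁻ embed z∈
    ... | i , i∈ , refl = ∈-commonNbrs⁺ Y (cone S) adjacent
      where
      adjacent : ∀ {k} → k ∈ cone S → adj Y k (embed i) ≡ true
      adjacent k∈ with ∈-cone⁻ S k∈
      ... | inj₁ refl             = adj-embed i
      ... | inj₂ (w , w∈S , refl) = trans (embed-adj w i) (∈-commonNbrs⁻ X S i∈ w∈S)

  ∣commonNbrs-cone∣ : ∀ S → ∣ commonNbrs Y (cone S) ∣ ≡ ∣ commonNbrs X S ∣
  ∣commonNbrs-cone∣ S = trans (cong ∣_∣ (commonNbrs-cone S)) (∣image∣≡∣p∣ embed embed-injective _)

  preimage : Subset m → Subset n
  preimage K = decSubset (λ i → embed i ∈? K)

  ∈-preimage⁺ : ∀ {K i} → embed i ∈ K → i ∈ preimage K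
  ∈-preimage⁺ {K} = ∈-decSubset⁺ (λ i → embed i ∈? K)

  ∈-preimage⁻ : ∀ {K i} → i ∈ preimage K → embed i ∈ K
  ∈-preimage⁻ {K} = ∈-decSubset⁻ (λ i → embed i ∈? K)

  preimage-clique : ∀ {K} → IsClique Y K → IsClique X (preimage K)
  preimage-clique K-clique i j i∈ j∈ i≢j = trans (sym (embed-adj i j))
    (K-clique _ _ (∈-preimage⁻ i∈) (∈-preimage⁻ j∈) (i≢j ∘ embed-injective))

  cone-preimage : ∀ {K} → IsClique Y K → y ∈ K → cone (preimage K) ≡ K
  cone-preimage {K} K-clique y∈K = ⊆-antisym inK fromK
    where
    inK : cone (preimage K) ⊆ K
    inK z∈ with ∈-cone⁻ (preimage K) z∈
    ... | inj₁ refl            = y∈K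
    ... | inj₂ (i , i∈ , refl) = ∈-preimage⁻ i∈
    fromK : K ⊆ cone (preimage K)
    fromK {z} z∈K with z ≟ y
    ... | yes refl = y∈cone (preimage K)
    ... | no  z≢y  = subst (_∈ cone (preimage K)) (embed-pull yz)
      (embed∈cone (∈-preimage⁺ (subst (_∈ K) (sym (embed-pull yz)) z∈K)))
      where
      yz : adj Y y z ≡ true
      yz = K-clique y z y∈K z∈K (z≢y ∘ sym)

module _ {n m : ℕ} {X : Graph n} {Y : Graph m} where

  transportIso : (σ : Automorphism Y) {y y′ : Fin m} → fun σ y ≡ y′ →
                 (iso : IsoToInducedNbhd X Y y) → IsoToInducedNbhd X Y y′
  transportIso σ {y} {y′} σy≡y′ iso =
    fun σ ∘ embed ,
    (λ i j → embed-injective ∘ fun-injective σ) ,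
    onto ,
    λ i j → trans (preserv σ (embed i) (embed j)) (embed-adj i j)
    where
    open NbhdIso X Y iso
    y≡σ⁻¹y′ : y ≡ inv σ y′
    y≡σ⁻¹y′ = trans (sym (inv-l σ y)) (cong (inv σ) σy≡y′)
    onto : ∀ z → (adj Y y′ z ≡ true) ⇔ (∃ λ i → fun σ (embed i) ≡ z)
    onto z = mk⇔
      (λ y′z → let yσ⁻¹z = trans (cong (λ u → adj Y u (inv σ z)) y≡σ⁻¹y′)
                                 (trans (inv-preserv σ y′ z) y′z)
               in pull yσ⁻¹z , trans (cong (fun σ) (embed-pull yσ⁻¹z)) (inv-r σ z))
      (λ { (i , refl) → trans (cong (λ u → adj Y u (fun σ (embed i))) (sym σy≡y′))
                               (trans (preserv σ y (embed i)) (adj-embed i)) })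

  asymmetric⇒iso-unique : Asymmetric X → {y : Fin m} (φ ψ : IsoToInducedNbhd X Y y) →
                          ∀ i → proj₁ φ i ≡ proj₁ ψ i
  asymmetric⇒iso-unique asym {y} φ ψ i = trans (sym (embed-relabel φ ψ i)) (cong (proj₁ ψ) (asym τ i))
    where
    module Φ = NbhdIso X Y φ
    module Ψ = NbhdIso X Y ψ
    relabel : (φ ψ : IsoToInducedNbhd X Y y) → Fin n → Fin n
    relabel φ ψ i = NbhdIso.pull X Y ψ (NbhdIso.adj-embed X Y φ i)
    embed-relabel : (φ ψ : IsoToInducedNbhd X Y y) → ∀ i → proj₁ ψ (relabel φ ψ i) ≡ proj₁ φ i
    embed-relabel φ ψ i = NbhdIso.embed-pull X Y ψ (NbhdIso.adj-embed X Y φ i)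
    τ : Automorphism X
    τ = record
      { fun     = relabel φ ψ
      ; inv     = relabel ψ φ
      ; inv-l   = λ i → Φ.embed-injective (trans (embed-relabel ψ φ _) (embed-relabel φ ψ i))
      ; inv-r   = λ i → Ψ.embed-injective (trans (embed-relabel φ ψ _) (embed-relabel ψ φ i))
      ; preserv = λ i j → trans (sym (Ψ.embed-adj _ _))
          (trans (cong₂ (adj Y) (embed-relabel φ ψ i) (embed-relabel φ ψ j)) (Φ.embed-adj i j))
      }

  stabiliser-fixes-nbrs : Asymmetric X → {y : Fin m} → IsoToInducedNbhd X Y y →
    (σ : Automorphism Y) → fun σ y ≡ y → ∀ {z} → adj Y y z ≡ true → fun σ z ≡ z
  stabiliser-fixes-nbrs asym {y} iso σ σy≡y {z} yz = begin
    fun σ z                 ≡⟨ cong (fun σ) (embed-pull yz) ⟨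
    fun σ (embed (pull yz)) ≡⟨ asymmetric⇒iso-unique asym (transportIso σ σy≡y iso) iso (pull yz) ⟩
    embed (pull yz)         ≡⟨ embed-pull yz ⟩
    z                       ∎
    where
    open ≡-Reasoning
    open NbhdIso X Y iso

UniqueByCommonNbrCount : {n : ℕ} → Graph n → Subset n → Set
UniqueByCommonNbrCount X S =
  ∀ T → IsClique X T → ∣ T ∣ ≡ ∣ S ∣ → T ≢ S → ∣ commonNbrs X T ∣ ≢ ∣ commonNbrs X S ∣

module _ {n m : ℕ} {X : Graph n} {Y : Graph m} {y : Fin m} (iso : IsoToInducedNbhd X Y y) where

  open NbhdIso X Y iso

  -- σ ∘ embed is an isomorphism onto N(σ y); as σ y ∈ cone S, the clique cone S is also the cone
  -- over its pullback S′ along σ ∘ embed, so S′ has the order and common-neighbour count of S.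
  cone-invariant : ∀ {S} → IsClique X S → UniqueByCommonNbrCount X S →
    (σ : Automorphism Y) → fun σ y ∈ cone S → ∀ {z} → z ∈ cone S → fun σ z ∈ cone S
  cone-invariant {S} S-clique S-unique σ σy∈cone = invariant
    where
    module Shifted = NbhdIso X Y (transportIso {X = X} σ refl iso)
    S′ : Subset n
    S′ = Shifted.preimage (cone S)
    cone-clique-S : IsClique Y (cone S)
    cone-clique-S = cone-clique S-clique
    coneS′≡coneS : Shifted.cone S′ ≡ cone S
    coneS′≡coneS = Shifted.cone-preimage cone-clique-S σy∈cone
    ∣S′∣≡∣S∣ : ∣ S′ ∣ ≡ ∣ S ∣
    ∣S′∣≡∣S∣ = suc-injective (trans (sym (Shifted.∣cone∣ S′)) (trans (cong ∣_∣ coneS′≡coneS) (∣cone∣ S)))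
    same-count : ∣ commonNbrs X S′ ∣ ≡ ∣ commonNbrs X S ∣
    same-count = trans (sym (Shifted.∣commonNbrs-cone∣ S′))
      (trans (cong (∣_∣ ∘ commonNbrs Y) coneS′≡coneS) (∣commonNbrs-cone∣ S))
    S′≡S : S′ ≡ S
    S′≡S with Vec.≡-dec Bool._≟_ S′ S
    ... | yes S′≡S = S′≡S
    ... | no  S′≢S =
      contradiction same-count (S-unique S′ (Shifted.preimage-clique cone-clique-S) ∣S′∣≡∣S∣ S′≢S)
    invariant : ∀ {z} → z ∈ cone S → fun σ z ∈ cone S
    invariant z∈ with ∈-cone⁻ S z∈
    ... | inj₁ refl             = σy∈cone
    ... | inj₂ (i , i∈S , refl) = Shifted.∈-preimage⁻ (subst (i ∈_) (sym S′≡S) i∈S)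

module _ {n m : ℕ} {X : Graph n} {Y : Graph m} (asym : Asymmetric X) (ind : InducedNbhdOf X Y) where

  power-fixes-nbr : (σ : Automorphism Y) → ∀ k {u v} →
                    (fun σ ^ k) u ≡ u → adj Y u v ≡ true → (fun σ ^ k) v ≡ v
  power-fixes-nbr σ k {u} {v} σᵏu≡u uv = trans (sym (fun-^ᴬ σ k v))
    (stabiliser-fixes-nbrs asym (ind u) (σ ^ᴬ k) (trans (fun-^ᴬ σ k u) σᵏu≡u) uv)

  -- A power of σ fixing y fixes all of N[y], and one fixing a neighbour of y fixes y.
  uniformOrbits-in-closedNbhd : (σ : Automorphism Y) {y : Fin m} {d : ℕ} {A : Subset m} →
    LeastPeriod (fun σ) y d → (∀ {x} → x ∈ A → x ≡ y ⊎ adj Y y x ≡ true) →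
    (∀ {x} → x ∈ A → fun σ x ∈ A) → UniformOrbits (fun σ) d A
  uniformOrbits-in-closedNbhd σ {y} {d} {A} y-period A⊆N[y] A-closed =
    record { closed = A-closed ; period = period }
    where
    open LeastPeriod y-period
    period : ∀ {x} → x ∈ A → LeastPeriod (fun σ) x d
    period x∈A with A⊆N[y] x∈A
    ... | inj₁ refl = y-period
    ... | inj₂ yx   = record
      { positive = positive
      ; returns  = power-fixes-nbr σ d returns yx
      ; minimal  = λ {i} i>0 i<d σⁱx≡x →
          minimal i>0 i<d (power-fixes-nbr σ i σⁱx≡x (trans (adj-sym Y _ y) yx))
      }

  cone-invariant⇒period∣ : (σ : Automorphism Y) {y : Fin m} {S : Subset n} {d : ℕ} →
    LeastPeriod (fun σ) y d →
    (∀ {z} → z ∈ NbhdIso.cone X Y (ind y) S → fun σ z ∈ NbhdIso.cone X Y (ind y) S) →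
    (d ∣ suc (∣ S ∣)) × (d ∣ ∣ commonNbrs X S ∣)
  cone-invariant⇒period∣ σ {y} {S} {d} y-period invariant =
    subst (d ∣_) (∣cone∣ S) (uniformOrbits⇒d∣∣A∣ cone-orbits) ,
    subst (d ∣_) (∣commonNbrs-cone∣ S) (uniformOrbits⇒d∣∣A∣ commonNbrs-orbits)
    where
    open NbhdIso X Y (ind y)
    cone-orbits : UniformOrbits (fun σ) d (cone S)
    cone-orbits = uniformOrbits-in-closedNbhd σ y-period (cone⊆closedNbhd S) invariant
    commonNbrs-orbits : UniformOrbits (fun σ) d (commonNbrs Y (cone S))
    commonNbrs-orbits = uniformOrbits-in-closedNbhd σ y-period
      (λ z∈ → inj₂ (∈-commonNbrs⁻ Y (cone S) z∈ (y∈cone S)))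
      (commonNbrs-invariant σ (uniformOrbits⇒surjective cone-orbits))

  apex-moved-within-cone⇒p∣∣commonNbrs∣ : {p : ℕ} → Prime p → {y : Fin m} {S : Subset n} →
    IsClique X S → UniqueByCommonNbrCount X S → suc ∣ S ∣ ≡ p →
    (h : Automorphism Y) → fun h y ≢ y → fun h y ∈ NbhdIso.cone X Y (ind y) S → p ∣ ∣ commonNbrs X S ∣
  apex-moved-within-cone⇒p∣∣commonNbrs∣ p-prime {y} {S} S-clique S-unique ∣cone∣≡p h hy≢y hy∈cone
    with leastPeriod (fun-injective h) y
  ... | d , y-period
    with cone-invariant⇒period∣ h {S = S} y-period (cone-invariant {X = X} (ind y) S-clique S-unique h hy∈cone)
  ... | d∣∣cone∣ , d∣∣commonNbrs∣ with prime⇒irreducible p-prime (subst (d ∣_) ∣cone∣≡p d∣∣cone∣)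
  ... | inj₁ refl = contradiction (LeastPeriod.returns y-period) hy≢y
  ... | inj₂ refl = d∣∣commonNbrs∣

corollary2p10p1 : (n : ℕ) (X : Graph n) → Asymmetric X →
    (p : ℕ) → Prime p →
    (S : Subset n) → IsClique X S → ∣ S ∣ ≡ p ∸ 1 →
    (∀ (T : Subset n) → IsClique X T → ∣ T ∣ ≡ p ∸ 1 → T ≢ S →
      ∣ commonNbrs X T ∣ ≢ ∣ commonNbrs X S ∣) →
    ¬ (p ∣ ∣ commonNbrs X S ∣) →
    (m : ℕ) (Y : Graph (suc m)) → VertexTransitive Y → ¬ InducedNbhdOf X Y
corollary2p10p1 n X asym p p-prime S S-clique ∣S∣≡p∸1 S-unique p∤∣commonNbrs∣ m Y vt ind =
  let s , s∈S  = ∣p∣>0⇒Nonempty S (subst (0 <_) (sym ∣S∣≡p∸1) (m<n⇒0<n∸m 1<p))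
      h , h0≡s = vt zero (embed s)
  in p∤∣commonNbrs∣ (apex-moved-within-cone⇒p∣∣commonNbrs∣ asym ind p-prime S-clique unique ∣cone∣≡p h
       (subst (_≢ zero) (sym h0≡s) (embed≢y s))
       (subst (_∈ cone S) (sym h0≡s) (embed∈cone s∈S)))
  where
  open NbhdIso X Y (ind zero)
  1<p : 1 < p
  1<p = nonTrivial⇒n>1 p {{prime⇒nonTrivial p-prime}}
  ∣cone∣≡p : suc ∣ S ∣ ≡ p
  ∣cone∣≡p = trans (cong suc ∣S∣≡p∸1) (m+[n∸m]≡n (<⇒≤ 1<p))
  unique : UniqueByCommonNbrCount X S
  unique T T-clique ∣T∣≡∣S∣ = S-unique T T-clique (trans ∣T∣≡∣S∣ ∣S∣≡p∸1)
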